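{- For all integers $n \ge m \ge 2$, every set of blocks $B$ on the rectangular grid $G_{n,m}$ that is a solution of the block/pass sliding game starting from $(1,1)$ satisfies $|B| \ge t(m-2)$, where for an integer $k\ge 0$ we set $t(k)=2\lfloor k/4\rfloor+1$ if $k\equiv 1 \pmod 4$ and $t(k)=2\lfloor k/4\rfloor$ otherwise. In other words, $\mathrm{opt}^{P}_{B}(G_{n,m}) \ge t(m-2)$.
   Context: $G_{n,m}$ is the rectangular grid with $n$ rows and $m$ columns; its squares are the pairs $(i,j)$ with $1\le i\le n$, $1\le j\le m$. Some squares are occupied by blocks (the square $(1,1)$ is free). A single robot starts on $(1,1)$. A move consists of choosing one of the four directions (up, down, left, right); the robot then slides square by square in that direction and stops on the last free square before it would enter a block or leave the grid. The robot passes over every square it occupies during a move (including the starting and stopping squares). A set of blocks is a solution of the block/pass game if for every free square $(i,j)$ there is a sequence of moves from $(1,1)$ during which the robot passes over $(i,j)$. $\mathrm{opt}^{P}_{B}(G_{n,m})$ denotes the minimum number of blocks in such a solution. The quantity $t(k)$ equals the total domination number $\gamma_t(P_k)$ of the path on $k$ vertices for $k\ge 2$. -}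

module Defs where

open import Data.Nat using (ℕ; zero; suc; _+_; _*_; _/_; _%_)
open import Data.Nat.Properties using (_≟_)
open import Data.Fin using (Fin; toℕ)
open import Data.Bool using (Bool; true; false; if_then_else_)
open import Data.List using (List; map; allFin)
open import Data.Nat.ListAction using (sum)
open import Data.Product using (_×_; _,_; Σ; ∃)
open import Relation.Nullary using (yes; no)
open import Relation.Binary.PropositionalEquality using (_≡_)

-- Squares of G_{n,m}: (i , j) with i : Fin n (row), j : Fin m (column),
-- 0-indexed, so the paper's square (i,j) is (i-1 , j-1) here.
Square : ℕ → ℕ → Set
Square n m = Fin n × Fin m

Blocks : ℕ → ℕ → Set
Blocks n m = Fin n → Fin m → Bool

Free : ∀ {n m} → Blocks n m → Square n m → Set
Free B (i , j) = B i j ≡ false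

Blocked : ∀ {n m} → Blocks n m → Square n m → Set
Blocked B (i , j) = B i j ≡ true

count : ∀ {n m} → Blocks n m → ℕ
count {n} {m} B =
  sum (map (λ i → sum (map (λ j → if B i j then 1 else 0) (allFin m))) (allFin n))

data Dir : Set where
  up down left right : Dir

Adj : ∀ {n m} → Dir → Square n m → Square n m → Set
Adj up    (i , j) (i' , j') = suc (toℕ i') ≡ toℕ i × j ≡ j'
Adj down  (i , j) (i' , j') = suc (toℕ i) ≡ toℕ i' × j ≡ j'
Adj left  (i , j) (i' , j') = i ≡ i' × suc (toℕ j') ≡ toℕ j
Adj right (i , j) (i' , j') = i ≡ i' × suc (toℕ j) ≡ toℕ j'

-- Slide B d p q : a move in direction d starting at p stops at q
-- (the robot advances while the next square exists and is free).
data Slide {n m} (B : Blocks n m) (d : Dir) : Square n m → Square n m → Set where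
  stop : ∀ {p} → (∀ p' → Adj d p p' → Blocked B p') → Slide B d p p
  step : ∀ {p p' q} → Adj d p p' → Free B p' → Slide B d p' q → Slide B d p q

-- OnPath B d p r : during the move in direction d starting at p the robot
-- passes over r (including the starting and the stopping square).
data OnPath {n m} (B : Blocks n m) (d : Dir) : Square n m → Square n m → Set where
  here : ∀ {p} → OnPath B d p p
  next : ∀ {p p' r} → Adj d p p' → Free B p' → OnPath B d p' r → OnPath B d p r

Origin : ∀ {n m} → Square n m → Set
Origin (i , j) = toℕ i ≡ 0 × toℕ j ≡ 0

data Reachable {n m} (B : Blocks n m) : Square n m → Set where
  start : ∀ {p} → Origin p → Reachable B p
  move  : ∀ {p q} (d : Dir) → Reachable B p → Slide B d p q → Reachable B q

Passed : ∀ {n m} → Blocks n m → Square n m → Set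
Passed B r = Σ _ λ p → Σ Dir λ d → Reachable B p × OnPath B d p r

IsSolution : ∀ {n m} → Blocks n m → Set
IsSolution B = (∀ p → Origin p → Free B p) × (∀ r → Free B r → Passed B r)

t : ℕ → ℕ
t k with k % 4 ≟ 1
... | yes _ = 2 * (k / 4) + 1
... | no  _ = 2 * (k / 4)

{-# OPTIONS --safe #-}
-- Write n = 2 + N and m = 2 + M. Since t k ≤ c as soon as k ≤ 2c, it suffices to show
-- M ≤ 2|B|. The robot can come to rest on an inner row only through a vertical move that
-- is stopped by a block in a neighbouring row, and symmetrically for columns.
-- If every inner row has a block in a neighbouring row, then, as a block neighbours at
-- most two rows, M ≤ N ≤ 2|B|. Otherwise some inner row r has both neighbouring rows
-- empty, so the robot never stands on r and each free square of r is passed over by a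
-- vertical move in its column. That move starts where a horizontal move was stopped by
-- a block outside r in a neighbouring column. So every inner column either has a block
-- in row r or a neighbouring column with a block outside r, and the same double
-- counting gives M ≤ 2|B|.
module Submission where

open import Defs
open import Data.Nat using (ℕ; _≤_; _∸_)
open import Data.Nat using (zero; suc; _+_; _*_; _<_; s≤s; z≤n; _≡ᵇ_; _/_; _%_; _≤?_)
open import Data.Nat.Properties
open import Data.Nat.DivMod using (m≡m%n+[m/n]*n)
open import Data.Nat.ListAction using (sum)
open import Data.Nat.Solver using (module +-*-Solver)
open import Algebra.Properties.CommutativeMonoid.Sum +-0-commutativeMonoid as FinSum
  using (∑-distrib-+; ∑-comm; sum-cong-≗; sum-replicate-zero)
open import Data.Fin as Fin using (Fin; toℕ; inject₁; fromℕ<)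
open import Data.Fin.Properties using (toℕ<n; toℕ-inject₁; toℕ-fromℕ<; all?; ¬∀⟶∃¬)
open import Data.Bool using (true; false; if_then_else_)
open import Data.List using (map; allFin; tabulate)
open import Data.List.Properties using (map-tabulate)
open import Data.Product using (∃; ∃₂; _×_; _,_; proj₂)
open import Data.Sum using (_⊎_; inj₁; inj₂)
open import Data.Empty using (⊥-elim)
open import Function using (_∘_)
open import Relation.Nullary using (¬_; yes; no)
open import Relation.Nullary.Decidable using (dec-false)
open import Relation.Binary.PropositionalEquality

k≤2*c⇒t≤c : ∀ {k c} → k ≤ 2 * c → t k ≤ c
k≤2*c⇒t≤c {k} {c} k≤2c with k % 4 ≟ 1
... | yes k%4≡1 = subst (_≤ c) (+-comm 1 (2 * q)) (*-cancelˡ-< 2 (2 * q) c (begin-strict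
    2 * (2 * q)        ≡⟨ trans (*-comm q 4) (*-assoc 2 2 q) ⟨
    q * 4              <⟨ n<1+n _ ⟩
    1 + q * 4          ≡⟨ cong (_+ q * 4) k%4≡1 ⟨
    k % 4 + q * 4      ≡⟨ m≡m%n+[m/n]*n k 4 ⟨
    k                  ≤⟨ k≤2c ⟩
    2 * c              ∎))
  where
  q = k / 4
  open ≤-Reasoning
... | no _ = *-cancelˡ-≤ 2 (begin
    2 * (2 * q)        ≡⟨ trans (*-comm q 4) (*-assoc 2 2 q) ⟨
    q * 4              ≤⟨ m≤n+m (q * 4) (k % 4) ⟩
    k % 4 + q * 4      ≡⟨ m≡m%n+[m/n]*n k 4 ⟨
    k                  ≤⟨ k≤2c ⟩
    2 * c              ∎)
  where
  q = k / 4
  open ≤-Reasoning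

sumBelow : ℕ → (ℕ → ℕ) → ℕ
sumBelow N f = FinSum.sum (λ (i : Fin N) → f (toℕ i))

sumBelow-≤-suc : ∀ N f → sumBelow N f ≤ sumBelow (suc N) f
sumBelow-≤-suc zero    f = z≤n
sumBelow-≤-suc (suc N) f = +-monoʳ-≤ (f 0) (sumBelow-≤-suc N (f ∘ suc))

sumBelow-positive⇒≥ : ∀ N f → (∀ (k : Fin N) → 1 ≤ f (toℕ k)) → N ≤ sumBelow N f
sumBelow-positive⇒≥ zero    f pos = z≤n
sumBelow-positive⇒≥ (suc N) f pos =
  +-mono-≤ (pos Fin.zero) (sumBelow-positive⇒≥ N (f ∘ suc) (pos ∘ Fin.suc))

term-≤-sumBelow : ∀ {N} f (k : Fin N) → f (toℕ k) ≤ sumBelow N f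
term-≤-sumBelow f Fin.zero    = m≤m+n _ _
term-≤-sumBelow f (Fin.suc k) = ≤-trans (term-≤-sumBelow (f ∘ suc) k) (m≤n+m _ (f 0))

sumBelow-remove : ∀ {N r} f → r < N →
  sumBelow N f ≡ sumBelow N (λ i → if i ≡ᵇ r then 0 else f i) + f r
sumBelow-remove {suc N} {zero}  f _         = +-comm (f 0) _
sumBelow-remove {suc N} {suc r} f (s≤s r<N) =
  trans (cong (f 0 +_) (sumBelow-remove (f ∘ suc) r<N)) (sym (+-assoc (f 0) _ _))

sum-allFin : ∀ {K} (f : Fin K → ℕ) → sum (map f (allFin K)) ≡ FinSum.sum f
sum-allFin f = trans (cong sum (map-tabulate (λ i → i) f)) (sum-tabulate f)
  where
  sum-tabulate : ∀ {K} (g : Fin K → ℕ) → sum (tabulate g) ≡ FinSum.sum g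
  sum-tabulate {zero}  g = refl
  sum-tabulate {suc K} g = cong (g Fin.zero +_) (sum-tabulate (g ∘ Fin.suc))

Adjacentℕ : ℕ → ℕ → Set
Adjacentℕ x y = suc x ≡ y ⊎ suc y ≡ x

-- Index k stands for the inner line 1 + k: a is weighed on its two neighbouring lines, s on
-- the line itself.
coverage : (a s : ℕ → ℕ) → ℕ → ℕ
coverage a s k = a k + a (2 + k) + s (1 + k)

Covers : (a s : ℕ → ℕ) → ℕ → Set
Covers a s K = ∀ (k : Fin K) → 1 ≤ coverage a s (toℕ k)

covered-or-gap : ∀ a s K → Covers a s K ⊎ ∃ λ (k : Fin K) → ¬ 1 ≤ coverage a s (toℕ k)
covered-or-gap a s K with all? (λ (k : Fin K) → 1 ≤? coverage a s (toℕ k))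
... | yes covered = inj₁ covered
... | no ¬covered = inj₂ (¬∀⟶∃¬ K _ (λ k → 1 ≤? coverage a s (toℕ k)) ¬covered)

neighbour-≤-coverage : ∀ a s {k x y} → x ≡ suc k → Adjacentℕ x y → a y ≤ coverage a s k
neighbour-≤-coverage a s {k} refl (inj₁ refl) = ≤-trans (m≤n+m _ (a k)) (m≤m+n _ _)
neighbour-≤-coverage a s refl (inj₂ refl) = ≤-trans (m≤m+n _ _) (m≤m+n _ _)

-- Each a j enters at most two coverages and each s j at most one.
covers⇒≤2*sum : ∀ K a s → Covers a s K → K ≤ 2 * (sumBelow (2 + K) a + sumBelow (2 + K) s)
covers⇒≤2*sum K a s covered = begin
  K
    ≤⟨ sumBelow-positive⇒≥ K (coverage a s) covered ⟩
  sumBelow K (coverage a s)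
    ≡⟨ ∑-distrib-+ {K} (λ k → a (toℕ k) + a (2 + toℕ k)) (λ k → s (1 + toℕ k)) ⟩
  sumBelow K (λ k → a k + a (2 + k)) + sumBelow K (s ∘ suc)
    ≡⟨ cong (_+ sumBelow K (s ∘ suc)) (∑-distrib-+ {K} (λ k → a (toℕ k)) (λ k → a (2 + toℕ k))) ⟩
  sumBelow K a + sumBelow K (a ∘ (2 +_)) + sumBelow K (s ∘ suc)
    ≤⟨ +-mono-≤ (+-mono-≤ a≤ a∘2+≤) s∘suc≤ ⟩
  A + A + C
    ≤⟨ m≤m+n (A + A + C) C ⟩
  A + A + C + C
    ≡⟨ solve 2 (λ A C → A :+ A :+ C :+ C := con 2 :* (A :+ C)) refl A C ⟩
  2 * (A + C)
    ∎
  where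
  open ≤-Reasoning
  open +-*-Solver
  A = sumBelow (2 + K) a
  C = sumBelow (2 + K) s
  a≤ : sumBelow K a ≤ A
  a≤ = ≤-trans (sumBelow-≤-suc K a) (sumBelow-≤-suc (suc K) a)
  a∘2+≤ : sumBelow K (a ∘ (2 +_)) ≤ A
  a∘2+≤ = ≤-trans (m≤n+m _ (a 1)) (m≤n+m _ (a 0))
  s∘suc≤ : sumBelow K (s ∘ suc) ≤ C
  s∘suc≤ = ≤-trans (sumBelow-≤-suc K (s ∘ suc)) (m≤n+m _ (s 0))

Inner : ℕ → ℕ → Set
Inner K x = 1 ≤ x × suc x < K

suc-Inner : ∀ {K} (k : Fin K) → Inner (2 + K) (suc (toℕ k))
suc-Inner k = s≤s z≤n , s≤s (s≤s (toℕ<n k))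

inner : ∀ {K} → Fin K → Fin (2 + K)
inner k = Fin.suc (inject₁ k)

toℕ-inner : ∀ {K} (k : Fin K) → toℕ (inner k) ≡ suc (toℕ k)
toℕ-inner k = cong suc (toℕ-inject₁ k)

data Axis : Set where
  vertical horizontal : Axis

axis : Dir → Axis
axis up    = vertical
axis down  = vertical
axis left  = horizontal
axis right = horizontal

across : Axis → Axis
across vertical   = horizontal
across horizontal = vertical

axis-dichotomy : ∀ a b → a ≡ b ⊎ a ≡ across b
axis-dichotomy vertical   vertical   = inj₁ refl
axis-dichotomy vertical   horizontal = inj₂ refl
axis-dichotomy horizontal vertical   = inj₂ refl
axis-dichotomy horizontal horizontal = inj₁ refl

module _ {n m : ℕ} where

  coord : Axis → Square n m → ℕ
  coord vertical   (i , _) = toℕ i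
  coord horizontal (_ , j) = toℕ j

  size : Axis → ℕ
  size vertical   = n
  size horizontal = m

  Interior : Axis → Square n m → Set
  Interior a p = Inner (size a) (coord a p)

  Neighbours : Axis → Square n m → Square n m → Set
  Neighbours a p q = Adjacentℕ (coord a p) (coord a q) × coord (across a) p ≡ coord (across a) q

  adj⇒neighbours : ∀ {d p q} → Adj d p q → Neighbours (axis d) p q
  adj⇒neighbours {up}    (e , e′) = inj₂ e , cong toℕ e′
  adj⇒neighbours {down}  (e , e′) = inj₁ e , cong toℕ e′
  adj⇒neighbours {left}  (e , e′) = inj₂ e′ , cong toℕ e
  adj⇒neighbours {right} (e , e′) = inj₁ e′ , cong toℕ e

  interior⇒adj : ∀ d {p} → Interior (axis d) p → ∃ (Adj d p)
  interior⇒adj up    {Fin.zero  , _} (() , _)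
  interior⇒adj up    {Fin.suc i , j} _       = (inject₁ i , j) , cong suc (toℕ-inject₁ i) , refl
  interior⇒adj down  {i , j}         (_ , h) = (fromℕ< h , j) , sym (toℕ-fromℕ< h) , refl
  interior⇒adj left  {_ , Fin.zero}  (() , _)
  interior⇒adj left  {i , Fin.suc j} _       = (i , inject₁ j) , refl , cong suc (toℕ-inject₁ j)
  interior⇒adj right {i , j}         (_ , h) = (i , fromℕ< h) , refl , sym (toℕ-fromℕ< h)

  origin-not-interior : ∀ a {p} → Origin p → ¬ Interior a p
  origin-not-interior vertical   {Fin.zero  , _} _        (() , _)
  origin-not-interior vertical   {Fin.suc _ , _} (() , _) _
  origin-not-interior horizontal {_ , Fin.zero}  _        (() , _)
  origin-not-interior horizontal {_ , Fin.suc _} (_ , ()) _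

module _ {n m : ℕ} (B : Blocks n m) where

  slide-ends-at-block : ∀ {d p q r} → Slide B d p q → Adj d q r → Blocked B r
  slide-ends-at-block (stop blocked) = blocked _
  slide-ends-at-block (step _ _ s)   = slide-ends-at-block s

  slide-across : ∀ {d p q} → Slide B d p q → coord (across (axis d)) p ≡ coord (across (axis d)) q
  slide-across (stop _)     = refl
  slide-across (step a _ s) = trans (proj₂ (adj⇒neighbours a)) (slide-across s)

  onPath-across : ∀ {d p q} → OnPath B d p q → coord (across (axis d)) p ≡ coord (across (axis d)) q
  onPath-across here         = refl
  onPath-across (next a _ s) = trans (proj₂ (adj⇒neighbours a)) (onPath-across s)

  -- The last move changing the a-coordinate stopped against a block.
  reachable⇒blocked-neighbour : ∀ a {q} → Reachable B q → Interior a q →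
    ∃₂ λ q′ p → Reachable B q′ × coord a q′ ≡ coord a q × Blocked B p × Neighbours a q′ p
  reachable⇒blocked-neighbour a (start o) interior = ⊥-elim (origin-not-interior a o interior)
  reachable⇒blocked-neighbour a (move d R s) interior with axis-dichotomy a (axis d)
  ... | inj₁ refl =
    let p , adj = interior⇒adj d interior
    in _ , p , move d R s , refl , slide-ends-at-block s adj , adj⇒neighbours adj
  ... | inj₂ refl =
    let q′ , p , R′ , same , rest =
          reachable⇒blocked-neighbour a R (subst (Inner (size a)) (sym (slide-across s)) interior)
    in q′ , p , R′ , trans same (slide-across s) , rest

-- Extension by 0 beyond K, so that neighbouring lines can be indexed arithmetically.
atℕ : ∀ {K} → (Fin K → ℕ) → ℕ → ℕ
atℕ {zero}  f _       = 0
atℕ {suc K} f zero    = f Fin.zero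
atℕ {suc K} f (suc i) = atℕ (f ∘ Fin.suc) i

atℕ-toℕ : ∀ {K} (f : Fin K → ℕ) (i : Fin K) → atℕ f (toℕ i) ≡ f i
atℕ-toℕ f Fin.zero    = refl
atℕ-toℕ f (Fin.suc i) = atℕ-toℕ (f ∘ Fin.suc) i

module _ {n m : ℕ} (B : Blocks n m) where

  weight : ℕ → ℕ → ℕ
  weight i j = atℕ (λ i′ → atℕ (λ j′ → if B i′ j′ then 1 else 0) j) i

  weight-toℕ : ∀ i j → weight (toℕ i) (toℕ j) ≡ (if B i j then 1 else 0)
  weight-toℕ i j = trans (atℕ-toℕ _ i) (atℕ-toℕ _ j)

  rowCount : ℕ → ℕ
  rowCount i = sumBelow m (weight i)

  count-by-rows : count B ≡ sumBelow n rowCount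
  count-by-rows = trans (sum-allFin (λ i → sum (map (indicator i) (allFin m))))
    (sum-cong-≗ {n} λ i →
      trans (sum-allFin (indicator i)) (sum-cong-≗ {m} λ j → sym (weight-toℕ i j)))
    where
    indicator : Fin n → Fin m → ℕ
    indicator i j = if B i j then 1 else 0

  blocked⇒weight≡1 : ∀ {p} → Blocked B p → weight (coord vertical p) (coord horizontal p) ≡ 1
  blocked⇒weight≡1 {i , j} blocked = trans (weight-toℕ i j) (cong (if_then 1 else 0) blocked)

  blocked⇒rowCount-positive : ∀ {p} → Blocked B p → 1 ≤ rowCount (coord vertical p)
  blocked⇒rowCount-positive {i , j} blocked =
    subst (_≤ rowCount (toℕ i)) (blocked⇒weight≡1 blocked) (term-≤-sumBelow (weight (toℕ i)) j)

rows-covered⇒≤2*count : ∀ {N m} (B : Blocks (2 + N) m) →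
  Covers (rowCount B) (λ _ → 0) N → N ≤ 2 * count B
rows-covered⇒≤2*count {N} B covered = begin
  N                                ≤⟨ covers⇒≤2*sum N (rowCount B) (λ _ → 0) covered ⟩
  2 * (rows + sumBelow (2 + N) (λ _ → 0))
                                   ≡⟨ cong (λ z → 2 * (rows + z)) (sum-replicate-zero (2 + N)) ⟩
  2 * (rows + 0)                   ≡⟨ cong (2 *_) (+-identityʳ rows) ⟩
  2 * rows                         ≡⟨ cong (2 *_) (count-by-rows B) ⟨
  2 * count B                      ∎
  where
  open ≤-Reasoning
  rows = sumBelow (2 + N) (rowCount B)

-- The hypothesis says that rows i and i + 2 contain no block.
module EmptyRowPair {N M : ℕ} (B : Blocks (2 + N) (2 + M)) (i : Fin N)
    (uncovered : ¬ 1 ≤ coverage (rowCount B) (λ _ → 0) (toℕ i)) where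

  middle : ℕ
  middle = suc (toℕ i)

  middle-unreachable : ∀ {q} → Reachable B q → coord vertical q ≢ middle
  middle-unreachable R e
    with reachable⇒blocked-neighbour B vertical R (subst (Inner (2 + N)) (sym e) (suc-Inner i))
  ... | _ , p , _ , e′ , blocked , adjacent , _ =
    uncovered (≤-trans (blocked⇒rowCount-positive B blocked)
                       (neighbour-≤-coverage (rowCount B) (λ _ → 0) (trans e′ e) adjacent))

  offMiddle : ℕ → ℕ → ℕ
  offMiddle i′ j = if i′ ≡ᵇ middle then 0 else weight B i′ j

  columnCountOffMiddle : ℕ → ℕ
  columnCountOffMiddle j = sumBelow (2 + N) (λ i′ → offMiddle i′ j)

  middleRow : ℕ → ℕ
  middleRow = weight B middle

  count-by-columns :
    count B ≡ sumBelow (2 + M) columnCountOffMiddle + sumBelow (2 + M) middleRow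
  count-by-columns = begin
    count B
      ≡⟨ count-by-rows B ⟩
    sumBelow (2 + N) (rowCount B)
      ≡⟨ ∑-comm {2 + N} {2 + M} (λ i′ j → weight B (toℕ i′) (toℕ j)) ⟩
    sumBelow (2 + M) (λ j → sumBelow (2 + N) (λ i′ → weight B i′ j))
      ≡⟨ sum-cong-≗ {2 + M} (λ j → sumBelow-remove (λ i′ → weight B i′ (toℕ j)) middle<2+N) ⟩
    sumBelow (2 + M) (λ j → columnCountOffMiddle j + middleRow j)
      ≡⟨ ∑-distrib-+ {2 + M} (columnCountOffMiddle ∘ toℕ) (middleRow ∘ toℕ) ⟩
    sumBelow (2 + M) columnCountOffMiddle + sumBelow (2 + M) middleRow
      ∎
    where
    open ≡-Reasoning
    middle<2+N = <⇒≤ (proj₂ (suc-Inner i))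

  blocked⇒columnCountOffMiddle-positive : ∀ {p} → Blocked B p → coord vertical p ≢ middle →
    1 ≤ columnCountOffMiddle (coord horizontal p)
  blocked⇒columnCountOffMiddle-positive {i′ , j} blocked off = begin
    1                            ≡⟨ blocked⇒weight≡1 B blocked ⟨
    w                            ≡⟨ cong (if_then 0 else w) (dec-false (toℕ i′ ≟ middle) off) ⟨
    offMiddle (toℕ i′) (toℕ j)   ≤⟨ term-≤-sumBelow (λ x → offMiddle x (toℕ j)) i′ ⟩
    columnCountOffMiddle (toℕ j) ∎
    where
    open ≤-Reasoning
    w = weight B (toℕ i′) (toℕ j)

  reachable-column-covered : ∀ {q} (k : Fin M) → Reachable B q → coord horizontal q ≡ suc (toℕ k) →
    1 ≤ coverage columnCountOffMiddle middleRow (toℕ k)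
  reachable-column-covered k R e
    with reachable⇒blocked-neighbour B horizontal R (subst (Inner (2 + M)) (sym e) (suc-Inner k))
  ... | _ , p , R′ , e′ , blocked , adjacent , sameRow =
    ≤-trans (blocked⇒columnCountOffMiddle-positive blocked (middle-unreachable R′ ∘ trans sameRow))
            (neighbour-≤-coverage columnCountOffMiddle middleRow (trans e′ e) adjacent)

  columns-covered : IsSolution B → Covers columnCountOffMiddle middleRow M
  columns-covered (_ , passed) k with B (inner i) (inner k) in free?
  ... | true = ≤-trans (≤-reflexive (sym centre≡1)) (m≤n+m _ _)
    where
    centre≡1 : middleRow (suc (toℕ k)) ≡ 1
    centre≡1 =
      subst₂ (λ x y → weight B x y ≡ 1) (toℕ-inner i) (toℕ-inner k) (blocked⇒weight≡1 B free?)
  ... | false with passed (inner i , inner k) free?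
  ...   | p , d , R , path with axis d | onPath-across B path
  ...     | horizontal | sameRow    = ⊥-elim (middle-unreachable R (trans sameRow (toℕ-inner i)))
  ...     | vertical   | sameColumn = reachable-column-covered k R (trans sameColumn (toℕ-inner k))

  M≤2*count : IsSolution B → M ≤ 2 * count B
  M≤2*count solution = begin
    M
      ≤⟨ covers⇒≤2*sum M columnCountOffMiddle middleRow (columns-covered solution) ⟩
    2 * (sumBelow (2 + M) columnCountOffMiddle + sumBelow (2 + M) middleRow)
      ≡⟨ cong (2 *_) count-by-columns ⟨
    2 * count B
      ∎
    where open ≤-Reasoning

M≤2*count : ∀ {N M} (B : Blocks (2 + N) (2 + M)) → IsSolution B → M ≤ N → M ≤ 2 * count B
M≤2*count {N} B solution M≤N with covered-or-gap (rowCount B) (λ _ → 0) N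
... | inj₁ covered         = ≤-trans M≤N (rows-covered⇒≤2*count B covered)
... | inj₂ (i , uncovered) = EmptyRowPair.M≤2*count B i uncovered solution

mainTheorem1 : (n m : ℕ) → 2 ≤ m → m ≤ n → (B : Blocks n m) →
    IsSolution B → t (m ∸ 2) ≤ count B
mainTheorem1 _ _ (s≤s (s≤s _)) (s≤s (s≤s M≤N)) B solution = k≤2*c⇒t≤c (M≤2*count B solution M≤N)
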